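{- Let $(\mathcal{G}_n)_{n\ge1}$ be the pseudofractal scale-free web. For every $n\geq 2$, $\mathcal{G}_n$ has exactly one maximum independent set (i.e., exactly one independent set of largest cardinality).
   Context: The pseudofractal scale-free web is the sequence of simple graphs $\mathcal{G}_n$, $n\ge 1$, defined by: $\mathcal{G}_1$ is a triangle; for $n>1$, $\mathcal{G}_n$ is obtained from $\mathcal{G}_{n-1}$ by adding, for every edge $(u,v)$ of $\mathcal{G}_{n-1}$, a new vertex adjacent to exactly $u$ and $v$. An independent set is a set of pairwise non-adjacent vertices. -}

module Defs where

open import Data.Nat using (ℕ; zero; suc; _≤_; _+_)
open import Data.Fin using (Fin; zero; suc; _↑ˡ_; _↑ʳ_)
open import Data.Fin.Subset using (Subset; _∈_; ∣_∣)
open import Data.List using (List; []; _∷_; _++_; length; lookup; concat; tabulate; map)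
open import Data.List.Membership.Propositional renaming (_∈_ to _∈ˡ_)
open import Data.Product using (_×_; _,_; Σ; ∃)
open import Data.Sum using (_⊎_)
open import Relation.Nullary using (¬_)
open import Relation.Binary.PropositionalEquality using (_≡_)

-- A finite graph: vertices Fin V, edges given as a list of unordered pairs
-- (each edge listed once, adjacency is the symmetric closure).
record Graph : Set where
  constructor mkGraph
  field
    V : ℕ
    E : List (Fin V × Fin V)
open Graph public

Adj : (G : Graph) → Fin (V G) → Fin (V G) → Set
Adj G x y = ((x , y) ∈ˡ E G) ⊎ ((y , x) ∈ˡ E G)

triangle : Graph
triangle = mkGraph 3 ((zero , suc zero) ∷ (suc zero , suc (suc zero)) ∷ (zero , suc (suc zero)) ∷ [])

-- One step: for every edge (u,v) (the i-th edge) add a new vertex w_i = V + i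
-- adjacent to exactly u and v; old edges are kept.
step : Graph → Graph
step (mkGraph n es) =
  mkGraph (n + length es)
    (map (λ { (u , v) → (u ↑ˡ length es , v ↑ˡ length es) }) es
     ++ concat (tabulate (λ i → newEdges i (lookup es i))))
  where
    newEdges : Fin (length es) → Fin n × Fin n → List (Fin (n + length es) × Fin (n + length es))
    newEdges i (u , v) = (u ↑ˡ length es , n ↑ʳ i) ∷ (v ↑ˡ length es , n ↑ʳ i) ∷ []

-- Pseudofractal scale-free web, indexed so that 𝒢 1 is the triangle
-- (𝒢 0 is also defined as the triangle, but is never used).
𝒢 : ℕ → Graph
𝒢 zero = triangle
𝒢 (suc zero) = triangle
𝒢 (suc (suc n)) = step (𝒢 (suc n))

Independent : (G : Graph) → Subset (V G) → Set
Independent G S = ∀ x y → x ∈ S → y ∈ S → ¬ Adj G x y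

MaximumIndependent : (G : Graph) → Subset (V G) → Set
MaximumIndependent G S =
  Independent G S × (∀ T → Independent G T → ∣ T ∣ ≤ ∣ S ∣)

UniqueMaximumIndependent : Graph → Set
UniqueMaximumIndependent G =
  Σ (Subset (V G)) λ S → MaximumIndependent G S × (∀ T → MaximumIndependent G T → T ≡ S)

-- Let G be a graph of minimum degree at least 2 with m edges.  Every edge uv of G spans
-- a triangle u v w in step G, so an independent set of step G, made of old vertices O
-- and new vertices N, meets each of these m triangles at most once.  Summing over the
-- triangles counts every vertex of O once per incident edge, hence at least twice:
-- ∣N∣ + 2∣O∣ ≤ m.  Thus the m new vertices, which are pairwise non-adjacent, form a
-- maximum independent set, and any independent set of size m has O = ∅ and N = all new
-- vertices.  The triangle has minimum degree 2 and step preserves this.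
module Submission where

open import Defs
open import Data.Nat using (ℕ; zero; suc; _+_; _*_; _≤_; z≤n; s≤s)
open import Data.Nat.Properties
  using ( +-*-semiring; +-comm; +-identityʳ; *-comm; *-identityʳ; *-zeroʳ
        ; ≤-refl; ≤-trans; ≤-antisym; +-mono-≤; +-monoʳ-≤; *-monoʳ-≤; +-cancelˡ-≤
        ; m≤m+n; m≤n+m; m≤n*m; n≤0⇒n≡0; module ≤-Reasoning )
open import Data.Nat.ListAction using (sum)
open import Data.Nat.ListAction.Properties using (sum-++)
open import Data.Nat.Tactic.RingSolver using (solve-∀)
open import Algebra.Properties.Semiring.Sum +-*-semiring
  using (sum-syntax; ∑-distrib-+; *-distribʳ-sum; sum-cong-≗; sum-replicate-zero)
  renaming (sum to ∑)
open import Data.Bool using (Bool; true; false)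
open import Data.Fin as Fin using (Fin; zero; suc; _↑ˡ_; _↑ʳ_)
open import Data.Fin.Properties using (_≟_; splitAt⁻¹-↑ˡ; splitAt⁻¹-↑ʳ)
open import Data.Fin.Subset using (Subset; _∈_; _∉_; ∣_∣; ⊥; ⊤)
open import Data.Fin.Subset.Properties using (∣⊥∣≡0; ∣⊤∣≡n; ∣p∣≤n; ∣p∣≡n⇒p≡⊤; ∉⊥)
open import Data.Vec as Vec using ([]; _∷_; _++_; splitAt)
open import Data.Vec.Properties using (lookup-++ˡ; lookup-++ʳ; lookup⇒[]=; []=⇒lookup)
open import Data.List using (List; []; _∷_; length; lookup; concat; tabulate; map)
  renaming (_++_ to _++ˡ_)
open import Data.List.Properties using (map-++)
open import Data.List.Membership.Propositional using () renaming (_∈_ to _∈ˡ_)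
open import Data.List.Membership.Propositional.Properties
  using (∈-++⁺ˡ; ∈-++⁺ʳ; ∈-map⁺; ∈-lookup; ∈-concat⁺′; ∈-tabulate⁺)
open import Data.List.Relation.Unary.Any using (here; there)
open import Data.List.Relation.Unary.All as All using (All)
open import Data.List.Relation.Unary.All.Properties using (++⁺; map⁺; concat⁺; tabulate⁺)
open import Data.Product using (_×_; _,_; ∃; proj₁; proj₂)
open import Data.Sum using (inj₁; inj₂)
open import Relation.Nullary using (does)
open import Relation.Nullary.Decidable using (dec-true)
open import Relation.Nullary.Negation using (contradiction)
open import Relation.Binary.PropositionalEquality

indicator : Bool → ℕ
indicator true  = 1
indicator false = 0

χ : ∀ {n} → Subset n → Fin n → ℕ
χ p x = indicator (Vec.lookup p x)

δ : ∀ {n} → Fin n → Fin n → ℕ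
δ y x = indicator (does (y ≟ x))

δ-refl : ∀ {n} (y : Fin n) → δ y y ≡ 1
δ-refl y = cong indicator (dec-true (y ≟ y) refl)

δ-↑ˡ : ∀ {n} m (a b : Fin n) → δ (a ↑ˡ m) (b ↑ˡ m) ≡ δ a b
δ-↑ˡ m zero    zero    = refl
δ-↑ˡ m zero    (suc b) = refl
δ-↑ˡ m (suc a) zero    = refl
δ-↑ˡ m (suc a) (suc b) = δ-↑ˡ m a b

∑-mono-≤ : ∀ {n} {f g : Fin n → ℕ} → (∀ i → f i ≤ g i) → ∑[ i < n ] f i ≤ ∑[ i < n ] g i
∑-mono-≤ {zero}  f≤g = z≤n
∑-mono-≤ {suc n} f≤g = +-mono-≤ (f≤g zero) (∑-mono-≤ (λ i → f≤g (suc i)))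

∑≤n : ∀ {n} {f : Fin n → ℕ} → (∀ i → f i ≤ 1) → ∑[ i < n ] f i ≤ n
∑≤n {zero}  f≤1 = z≤n
∑≤n {suc n} f≤1 = +-mono-≤ (f≤1 zero) (∑≤n (λ i → f≤1 (suc i)))

∑-*δ : ∀ {n} (w : Fin n → ℕ) y → ∑[ x < n ] (w x * δ y x) ≡ w y
∑-*δ {suc n} w zero = begin
  w zero * 1 + ∑[ x < n ] (w (suc x) * 0) ≡⟨ cong₂ _+_ (*-identityʳ (w zero)) ∑-*0 ⟩
  w zero + 0                              ≡⟨ +-identityʳ (w zero) ⟩
  w zero                                  ∎
  where
  open ≡-Reasoning
  ∑-*0 : ∑[ x < n ] (w (suc x) * 0) ≡ 0
  ∑-*0 = trans (sum-cong-≗ (λ x → *-zeroʳ (w (suc x)))) (sum-replicate-zero n)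
∑-*δ {suc n} w (suc y) =
  trans (cong (_+ ∑[ x < n ] (w (suc x) * δ y x)) (*-zeroʳ (w zero))) (∑-*δ (λ x → w (suc x)) y)

∑-lookup : ∀ {A : Set} (f : A → ℕ) (l : List A) →
  ∑[ i < length l ] f (lookup l i) ≡ sum (map f l)
∑-lookup f []      = refl
∑-lookup f (x ∷ l) = cong (f x +_) (∑-lookup f l)

∣p∣≡∑χ : ∀ {n} (p : Subset n) → ∣ p ∣ ≡ ∑[ x < n ] χ p x
∣p∣≡∑χ []          = refl
∣p∣≡∑χ (true  ∷ p) = cong suc (∣p∣≡∑χ p)
∣p∣≡∑χ (false ∷ p) = ∣p∣≡∑χ p

∣p++q∣ : ∀ {n m} (p : Subset n) (q : Subset m) → ∣ p ++ q ∣ ≡ ∣ p ∣ + ∣ q ∣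
∣p++q∣ []          q = refl
∣p++q∣ (true  ∷ p) q = cong suc (∣p++q∣ p q)
∣p++q∣ (false ∷ p) q = ∣p++q∣ p q

∣p∣≡0⇒p≡⊥ : ∀ {n} (p : Subset n) → ∣ p ∣ ≡ 0 → p ≡ ⊥
∣p∣≡0⇒p≡⊥ []          _     = refl
∣p∣≡0⇒p≡⊥ (false ∷ p) ∣p∣≡0 = cong (false ∷_) (∣p∣≡0⇒p≡⊥ p ∣p∣≡0)

χ-++ˡ : ∀ {n m} (p : Subset n) (q : Subset m) x → χ (p ++ q) (x ↑ˡ m) ≡ χ p x
χ-++ˡ p q x = cong indicator (lookup-++ˡ p q x)

χ-++ʳ : ∀ {n m} (p : Subset n) (q : Subset m) i → χ (p ++ q) (n ↑ʳ i) ≡ χ q i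
χ-++ʳ p q i = cong indicator (lookup-++ʳ p q i)

∈-++ˡ⁻ : ∀ {n m} (p : Subset n) (q : Subset m) x → x ↑ˡ m ∈ p ++ q → x ∈ p
∈-++ˡ⁻ p q x x∈p++q = lookup⇒[]= x p (trans (sym (lookup-++ˡ p q x)) ([]=⇒lookup x∈p++q))

independent-triangle : ∀ {H : Graph} {S : Subset (V H)} {a b c} → Independent H S →
  Adj H a b → Adj H a c → Adj H b c → χ S a + (χ S b + χ S c) ≤ 1
independent-triangle {S = S} {a} {b} {c} indep ab ac bc
  with Vec.lookup S a in a∈S | Vec.lookup S b in b∈S | Vec.lookup S c in c∈S
... | true  | true  | _     = contradiction ab (indep a b (lookup⇒[]= a S a∈S) (lookup⇒[]= b S b∈S))
... | true  | _     | true  = contradiction ac (indep a c (lookup⇒[]= a S a∈S) (lookup⇒[]= c S c∈S))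
... | _     | true  | true  = contradiction bc (indep b c (lookup⇒[]= b S b∈S) (lookup⇒[]= c S c∈S))
... | true  | false | false = ≤-refl
... | false | true  | false = ≤-refl
... | false | false | true  = ≤-refl
... | false | false | false = z≤n

incidence : ∀ {n} → Fin n → Fin n × Fin n → ℕ
incidence x (u , v) = δ u x + δ v x

degree : ∀ {n} → List (Fin n × Fin n) → Fin n → ℕ
degree es x = sum (map (incidence x) es)

endpointWeight : ∀ {n} → (Fin n → ℕ) → Fin n × Fin n → ℕ
endpointWeight w (u , v) = w u + w v

weighted-handshake : ∀ {n} (w : Fin n → ℕ) (es : List (Fin n × Fin n)) →
  sum (map (endpointWeight w) es) ≡ ∑[ x < n ] (w x * degree es x)
weighted-handshake {n} w [] = sym (trans (sum-cong-≗ (λ x → *-zeroʳ (w x))) (sum-replicate-zero n))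
weighted-handshake {n} w ((u , v) ∷ es) = begin
  w u + w v + sum (map (endpointWeight w) es)
    ≡⟨ cong₂ _+_ (sym (cong₂ _+_ (∑-*δ w u) (∑-*δ w v))) (weighted-handshake w es) ⟩
  ∑[ x < n ] (w x * δ u x) + ∑[ x < n ] (w x * δ v x) + ∑[ x < n ] (w x * degree es x)
    ≡⟨ cong (_+ ∑[ x < n ] (w x * degree es x)) (∑-distrib-+ (λ x → w x * δ u x) _) ⟨
  ∑[ x < n ] (w x * δ u x + w x * δ v x) + ∑[ x < n ] (w x * degree es x)
    ≡⟨ ∑-distrib-+ (λ x → w x * δ u x + w x * δ v x) _ ⟨
  ∑[ x < n ] (w x * δ u x + w x * δ v x + w x * degree es x)
    ≡⟨ sum-cong-≗ (λ x → distrib₃ (w x) (δ u x) (δ v x) (degree es x)) ⟩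
  ∑[ x < n ] (w x * degree ((u , v) ∷ es) x)
    ∎
  where
  open ≡-Reasoning
  distrib₃ : ∀ a b c d → a * b + a * c + a * d ≡ a * (b + c + d)
  distrib₃ = solve-∀

MinDegree≥2 : Graph → Set
MinDegree≥2 G = ∀ x → 2 ≤ degree (E G) x

2*∑≤∑endpointWeight : ∀ G → MinDegree≥2 G → (w : Fin (V G) → ℕ) →
  2 * ∑[ x < V G ] w x ≤ sum (map (endpointWeight w) (E G))
2*∑≤∑endpointWeight G deg≥2 w = begin
  2 * ∑[ x < V G ] w x              ≡⟨ *-comm 2 (∑[ x < V G ] w x) ⟩
  ∑[ x < V G ] w x * 2              ≡⟨ *-distribʳ-sum 2 w ⟩
  ∑[ x < V G ] (w x * 2)            ≤⟨ ∑-mono-≤ (λ x → *-monoʳ-≤ (w x) (deg≥2 x)) ⟩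
  ∑[ x < V G ] (w x * degree (E G) x) ≡⟨ weighted-handshake w (E G) ⟨
  sum (map (endpointWeight w) (E G)) ∎
  where open ≤-Reasoning

degree-++ : ∀ {n} (l r : List (Fin n × Fin n)) x → degree (l ++ˡ r) x ≡ degree l x + degree r x
degree-++ l r x = trans (cong sum (map-++ (incidence x) l r)) (sum-++ (map (incidence x) l) _)

degree-concat : ∀ {n} {l : List (Fin n × Fin n)} {ls} x → l ∈ˡ ls →
  degree l x ≤ degree (concat ls) x
degree-concat {l = l} {l ∷ ls} x (here refl) =
  subst (degree l x ≤_) (sym (degree-++ l (concat ls) x)) (m≤m+n _ _)
degree-concat {l = l} {l′ ∷ ls} x (there l∈ls) =
  subst (degree l x ≤_) (sym (degree-++ l′ (concat ls) x)) (≤-trans (degree-concat x l∈ls) (m≤n+m _ _))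

module StepGraph (G : Graph) where
  private
    n  = V G
    es = E G
    m  = length es

  old : Fin n → Fin (n + m)
  old x = x ↑ˡ m

  new : Fin m → Fin (n + m)
  new i = n ↑ʳ i

  newVertices : Subset (n + m)
  newVertices = ⊥ {n} ++ ⊤ {m}

  u v : Fin m → Fin n
  u i = proj₁ (lookup es i)
  v i = proj₂ (lookup es i)

  oldEdge : Fin n × Fin n → Fin (n + m) × Fin (n + m)
  oldEdge (a , b) = old a , old b

  newEdges : Fin m → Fin n × Fin n → List (Fin (n + m) × Fin (n + m))
  newEdges i (a , b) = (old a , new i) ∷ (old b , new i) ∷ []

  newEdgeLists : List (List (Fin (n + m) × Fin (n + m)))
  newEdgeLists = tabulate (λ i → newEdges i (lookup es i))

  new-adj-oldᵘ : ∀ i → Adj (step G) (new i) (old (u i))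
  new-adj-oldᵘ i = inj₂ (∈-++⁺ʳ (map oldEdge es)
    (∈-concat⁺′ (here refl) (∈-tabulate⁺ {f = λ j → newEdges j (lookup es j)} i)))

  new-adj-oldᵛ : ∀ i → Adj (step G) (new i) (old (v i))
  new-adj-oldᵛ i = inj₂ (∈-++⁺ʳ (map oldEdge es)
    (∈-concat⁺′ (there (here refl)) (∈-tabulate⁺ {f = λ j → newEdges j (lookup es j)} i)))

  oldᵘ-adj-oldᵛ : ∀ i → Adj (step G) (old (u i)) (old (v i))
  oldᵘ-adj-oldᵛ i = inj₁ (∈-++⁺ˡ (∈-map⁺ oldEdge (∈-lookup {xs = es} i)))

  degree-old : ∀ l x → degree (map oldEdge l) (old x) ≡ degree l x
  degree-old []            x = refl
  degree-old ((a , b) ∷ l) x =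
    cong₂ _+_ (cong₂ _+_ (δ-↑ˡ m a x) (δ-↑ˡ m b x)) (degree-old l x)

  degree-step : ∀ y →
    degree (E (step G)) y ≡ degree (map oldEdge es) y + degree (concat newEdgeLists) y
  degree-step = degree-++ (map oldEdge es) (concat newEdgeLists)

  old-degree≥2 : MinDegree≥2 G → ∀ x → 2 ≤ degree (E (step G)) (old x)
  old-degree≥2 deg≥2 x = begin
    2                                  ≤⟨ deg≥2 x ⟩
    degree es x                        ≡⟨ degree-old es x ⟨
    degree (map oldEdge es) (old x)    ≤⟨ m≤m+n _ _ ⟩
    degree (map oldEdge es) (old x) + degree (concat newEdgeLists) (old x)
                                       ≡⟨ degree-step (old x) ⟨
    degree (E (step G)) (old x)        ∎
    where open ≤-Reasoning

  new-degree≥2 : ∀ i → 2 ≤ degree (E (step G)) (new i)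
  new-degree≥2 i = begin
    2                                         ≡⟨ cong₂ _+_ (δ-refl (new i)) (δ-refl (new i)) ⟨
    δ (new i) (new i) + δ (new i) (new i)
      ≤⟨ +-mono-≤ (m≤n+m (δ (new i) (new i)) (δ (old (u i)) (new i)))
                  (≤-trans (m≤n+m (δ (new i) (new i)) (δ (old (v i)) (new i))) (m≤m+n _ 0)) ⟩
    degree (newEdges i (lookup es i)) (new i) ≤⟨ degree-concat (new i) (∈-tabulate⁺ i) ⟩
    degree (concat newEdgeLists) (new i)      ≤⟨ m≤n+m _ _ ⟩
    degree (map oldEdge es) (new i) + degree (concat newEdgeLists) (new i)
                                              ≡⟨ degree-step (new i) ⟨
    degree (E (step G)) (new i)               ∎
    where open ≤-Reasoning

  step-minDegree : MinDegree≥2 G → MinDegree≥2 (step G)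
  step-minDegree deg≥2 y with Fin.splitAt n y in y≡
  ... | inj₁ x = subst (λ z → 2 ≤ degree (E (step G)) z) (splitAt⁻¹-↑ˡ y≡) (old-degree≥2 deg≥2 x)
  ... | inj₂ i = subst (λ z → 2 ≤ degree (E (step G)) z) (splitAt⁻¹-↑ʳ y≡) (new-degree≥2 i)

  triangle-χ≤1 : ∀ O N → Independent (step G) (O ++ N) →
    ∀ i → χ N i + endpointWeight (χ O) (lookup es i) ≤ 1
  triangle-χ≤1 O N indep i =
    subst (_≤ 1) (cong₂ _+_ (χ-++ʳ O N i) (cong₂ _+_ (χ-++ˡ O N (u i)) (χ-++ˡ O N (v i))))
      (independent-triangle indep (new-adj-oldᵘ i) (new-adj-oldᵛ i) (oldᵘ-adj-oldᵛ i))

  independent⇒∣N∣+2∣O∣≤m : MinDegree≥2 G → ∀ O N → Independent (step G) (O ++ N) →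
    ∣ N ∣ + 2 * ∣ O ∣ ≤ m
  independent⇒∣N∣+2∣O∣≤m deg≥2 O N indep = begin
    ∣ N ∣ + 2 * ∣ O ∣
      ≡⟨ cong₂ (λ a b → a + 2 * b) (∣p∣≡∑χ N) (∣p∣≡∑χ O) ⟩
    ∑[ i < m ] χ N i + 2 * ∑[ x < n ] χ O x
      ≤⟨ +-monoʳ-≤ (∑[ i < m ] χ N i) (2*∑≤∑endpointWeight G deg≥2 (χ O)) ⟩
    ∑[ i < m ] χ N i + sum (map (endpointWeight (χ O)) es)
      ≡⟨ cong (∑[ i < m ] χ N i +_) (∑-lookup (endpointWeight (χ O)) es) ⟨
    ∑[ i < m ] χ N i + ∑[ i < m ] endpointWeight (χ O) (lookup es i)
      ≡⟨ ∑-distrib-+ (χ N) (λ i → endpointWeight (χ O) (lookup es i)) ⟨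
    ∑[ i < m ] (χ N i + endpointWeight (χ O) (lookup es i))
      ≤⟨ ∑≤n (triangle-χ≤1 O N indep) ⟩
    m ∎
    where open ≤-Reasoning

  independent⇒∣T∣≤m : MinDegree≥2 G → ∀ T → Independent (step G) T → ∣ T ∣ ≤ m
  independent⇒∣T∣≤m deg≥2 T indep with splitAt n T
  ... | O , N , refl = begin
    ∣ O ++ N ∣        ≡⟨ ∣p++q∣ O N ⟩
    ∣ O ∣ + ∣ N ∣     ≡⟨ +-comm ∣ O ∣ ∣ N ∣ ⟩
    ∣ N ∣ + ∣ O ∣     ≤⟨ +-monoʳ-≤ ∣ N ∣ (m≤n*m ∣ O ∣ 2) ⟩
    ∣ N ∣ + 2 * ∣ O ∣ ≤⟨ independent⇒∣N∣+2∣O∣≤m deg≥2 O N indep ⟩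
    m                 ∎
    where open ≤-Reasoning

  independent⇒m≤∣T∣⇒T≡newVertices : MinDegree≥2 G → ∀ T → Independent (step G) T →
    m ≤ ∣ T ∣ → T ≡ newVertices
  independent⇒m≤∣T∣⇒T≡newVertices deg≥2 T indep m≤∣T∣ with splitAt n T
  ... | O , N , refl = cong₂ _++_ (∣p∣≡0⇒p≡⊥ O ∣O∣≡0) (∣p∣≡n⇒p≡⊤ ∣N∣≡m)
    where
    upper : ∣ N ∣ + 2 * ∣ O ∣ ≤ m
    upper = independent⇒∣N∣+2∣O∣≤m deg≥2 O N indep
    lower : m ≤ ∣ O ∣ + ∣ N ∣
    lower = subst (m ≤_) (∣p++q∣ O N) m≤∣T∣
    rearrange : ∀ a b → b + 2 * a ≡ (a + b) + a
    rearrange = solve-∀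
    ∣O∣≡0 : ∣ O ∣ ≡ 0
    ∣O∣≡0 = n≤0⇒n≡0 (+-cancelˡ-≤ (∣ O ∣ + ∣ N ∣) ∣ O ∣ 0
      (subst₂ _≤_ (rearrange ∣ O ∣ ∣ N ∣) (sym (+-identityʳ _)) (≤-trans upper lower)))
    ∣N∣≡m : ∣ N ∣ ≡ m
    ∣N∣≡m = ≤-antisym (∣p∣≤n N) (subst (λ a → m ≤ a + ∣ N ∣) ∣O∣≡0 lower)

  edges-start-old : All (λ e → ∃ λ x → proj₁ e ≡ old x) (E (step G))
  edges-start-old = ++⁺ (map⁺ (All.tabulate (λ {e} _ → proj₁ e , refl)))
    (concat⁺ (tabulate⁺ (λ i → (u i , refl) All.∷ (v i , refl) All.∷ All.[])))

  old∉newVertices : ∀ x → old x ∉ newVertices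
  old∉newVertices x x∈ = ∉⊥ (∈-++ˡ⁻ (⊥ {n}) (⊤ {m}) x x∈)

  newVertices-independent : Independent (step G) newVertices
  newVertices-independent x y x∈ y∈ (inj₁ xy) with All.lookup edges-start-old xy
  ... | z , refl = old∉newVertices z x∈
  newVertices-independent x y x∈ y∈ (inj₂ yx) with All.lookup edges-start-old yx
  ... | z , refl = old∉newVertices z y∈

  ∣newVertices∣≡m : ∣ newVertices ∣ ≡ m
  ∣newVertices∣≡m = trans (∣p++q∣ (⊥ {n}) (⊤ {m})) (cong₂ _+_ (∣⊥∣≡0 n) (∣⊤∣≡n m))

  step-unique : MinDegree≥2 G → UniqueMaximumIndependent (step G)
  step-unique deg≥2 = newVertices , (newVertices-independent , maximum) , unique
    where
    maximum : ∀ T → Independent (step G) T → ∣ T ∣ ≤ ∣ newVertices ∣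
    maximum T indep = subst (∣ T ∣ ≤_) (sym ∣newVertices∣≡m) (independent⇒∣T∣≤m deg≥2 T indep)
    unique : ∀ T → MaximumIndependent (step G) T → T ≡ newVertices
    unique T (indep , max) = independent⇒m≤∣T∣⇒T≡newVertices deg≥2 T indep
      (subst (_≤ ∣ T ∣) ∣newVertices∣≡m (max newVertices newVertices-independent))

open StepGraph using (step-unique; step-minDegree)

triangle-minDegree : MinDegree≥2 triangle
triangle-minDegree zero             = s≤s (s≤s z≤n)
triangle-minDegree (suc zero)       = s≤s (s≤s z≤n)
triangle-minDegree (suc (suc zero)) = s≤s (s≤s z≤n)

𝒢-minDegree : ∀ k → MinDegree≥2 (𝒢 (suc k))
𝒢-minDegree zero    = triangle-minDegree
𝒢-minDegree (suc k) = step-minDegree (𝒢 (suc k)) (𝒢-minDegree k)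

mainTheorem2 : (n : ℕ) → 2 ≤ n → UniqueMaximumIndependent (𝒢 n)
mainTheorem2 (suc (suc k)) _ = step-unique (𝒢 (suc k)) (𝒢-minDegree k)
mainTheorem2 (suc zero) (s≤s ())
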